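{- Let $G$ be a graph with vertex set $\{v_1,\dots,v_n\}$, let $\mathbf F$ be a field and $m=wcdim(G,\mathbf F)$. Let $t\in\mathbb N$ and $H=G(tv_1)$. Then $wcdim(H,\mathbf F)=m+t-1$.
   Context: All graphs are finite, simple and undirected. An independent set of a graph $G$ is a set of pairwise non-adjacent vertices; it is maximal if it is not properly contained in another independent set. For a field $\mathbf F$, a well-covered weighting of $G$ is a function $w:V(G)\to\mathbf F$ such that $\sum_{x\in M}w(x)$ takes the same value for every maximal independent set $M$ of $G$. The well-covered weightings form an $\mathbf F$-vector space, whose dimension is denoted $wcdim(G,\mathbf F)$. For $t\in\mathbb N=\{1,2,\dots\}$ and $v\in V(G)$, the $t$-blowup $G(tv)$ is the graph obtained from $G$ by replacing $v$ with an independent set of $t$ new vertices $v_{1},\dots,v_{t}$, each of which is adjacent exactly to the neighbours of $v$ in $G$ (all other adjacencies unchanged). In particular $G(1v)=G$. -}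

module Defs where

open import Level using (Level; _⊔_) renaming (suc to lsuc)
open import Data.Nat using (ℕ; zero; suc) renaming (_+_ to _+ℕ_)
open import Data.Fin using (Fin; zero; suc; splitAt)
open import Data.Bool using (Bool; true; false; if_then_else_)
open import Data.Sum using (inj₁; inj₂)
open import Data.Product using (Σ; ∃; _×_; _,_)
open import Relation.Nullary using (¬_)
open import Relation.Binary.PropositionalEquality using (_≡_)
open import Algebra.Bundles using (CommutativeRing)

record Field (c ℓ : Level) : Set (lsuc (c ⊔ ℓ)) where
  field
    commutativeRing : CommutativeRing c ℓ
  open CommutativeRing commutativeRing public
  field
    1#≉0#   : ¬ (1# ≈ 0#)
    inverse : ∀ x → ¬ (x ≈ 0#) → ∃ λ y → x * y ≈ 1#

record Graph (n : ℕ) : Set₁ where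
  field
    Adj     : Fin n → Fin n → Set
    symm    : ∀ {x y} → Adj x y → Adj y x
    irrefl  : ∀ {x} → ¬ Adj x x

open Graph public

VSet : ℕ → Set
VSet n = Fin n → Bool

_∈_ : ∀ {n} → Fin n → VSet n → Set
x ∈ S = S x ≡ true

_⊆_ : ∀ {n} → VSet n → VSet n → Set
S ⊆ T = ∀ x → x ∈ S → x ∈ T

Independent : ∀ {n} → Graph n → VSet n → Set
Independent G S = ∀ x y → x ∈ S → y ∈ S → ¬ Adj G x y

MaximalIndependent : ∀ {n} → Graph n → VSet n → Set
MaximalIndependent G S =
  Independent G S × (∀ T → Independent G T → S ⊆ T → T ⊆ S)

-- The t-blowup of the vertex v₁ (= zero) of a graph on Fin (suc n).
-- Vertices of G(t v₁) are Fin (t +ℕ n): the first t are the copies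
-- v₁,…,v_t of v₁, the remaining n are the vertices v₂,…,v_{n+1} of G.

blowMap : ∀ {n} (t : ℕ) → Fin (t +ℕ n) → Fin (suc n)
blowMap {n} t i with splitAt t i
... | inj₁ _ = zero
... | inj₂ j = suc j

blowup : ∀ {n} → Graph (suc n) → (t : ℕ) → Graph (t +ℕ n)
blowup G t = record
  { Adj    = λ i j → Adj G (blowMap t i) (blowMap t j)
  ; symm   = symm G
  ; irrefl = irrefl G
  }

module _ {c ℓ : Level} (F : Field c ℓ) where
  open Field F using (Carrier; _≈_; _+_; _*_; 0#)

  ∑ : ∀ {k} → (Fin k → Carrier) → Carrier
  ∑ {zero}  f = 0#
  ∑ {suc k} f = f zero + ∑ (λ i → f (suc i))

  weightOf : ∀ {n} → (Fin n → Carrier) → VSet n → Carrier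
  weightOf w S = ∑ (λ x → if S x then w x else 0#)

  WellCovered : ∀ {n} → Graph n → (Fin n → Carrier) → Set _
  WellCovered G w = ∀ M M' → MaximalIndependent G M → MaximalIndependent G M'
                    → weightOf w M ≈ weightOf w M'

  record HasDimension {n : ℕ} {p} (W : (Fin n → Carrier) → Set p) (d : ℕ)
         : Set (c ⊔ ℓ ⊔ p) where
    field
      basis    : Fin d → (Fin n → Carrier)
      inW      : ∀ i → W (basis i)
      linIndep : ∀ (a : Fin d → Carrier)
                 → (∀ x → ∑ (λ i → a i * basis i x) ≈ 0#)
                 → ∀ i → a i ≈ 0#
      spans    : ∀ w → W w
                 → ∃ λ (a : Fin d → Carrier) → ∀ x → w x ≈ ∑ (λ i → a i * basis i x)

  WCDim : ∀ {n} → Graph n → ℕ → Set _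
  WCDim G d = HasDimension (WellCovered G) d

module Submission where

-- Write t = suc s, H = G(t v₁), and π = blowMap t : V(H) → V(G) for the
-- map sending every copy of v₁ to v₁.  H is the pullback of G along π, so
-- the copies of v₁ are twins and the maximal independent sets of H are
-- exactly the inflations M ∘ π of those M of G.  Let push : F^V(H) → F^V(G)
-- sum a weighting over the fibres of π.  Since  w(M ∘ π) = (push w)(M),
-- w is well-covered on H iff push w is well-covered on G; that is,
-- WC(H) = push⁻¹(WC(G)).  A linear map with a section pulls an
-- m-dimensional space back to an (m + dim ker)-dimensional one, and the
-- kernel of push (vectors vanishing outside the copies, whose values on the
-- copies sum to 0) has the basis  e_{copy (j+1)} - e_{copy 0},  j < s.

open import Defs
open import Level using (Level)
open import Data.Nat using (ℕ; zero; suc; _+_; _∸_; _≤_)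
open import Data.Nat.Properties using (+-suc)
open import Data.Fin using (Fin; zero; suc; _↑ˡ_; _↑ʳ_; splitAt; _≟_)
open import Data.Fin.Properties using (splitAt-↑ˡ; splitAt-↑ʳ; splitAt⁻¹-↑ˡ; splitAt⁻¹-↑ʳ)
open import Data.Vec.Functional using (_∷_; _++_)
open import Data.Vec.Functional.Properties using (lookup-++ˡ; lookup-++ʳ)
open import Data.Bool using (Bool; true; false; if_then_else_)
open import Data.Sum using (_⊎_; inj₁; inj₂)
open import Data.Product using (∃; _,_; proj₁; proj₂)
open import Relation.Nullary using (¬_; yes; no; contradiction)
open import Relation.Binary.PropositionalEquality as P using (_≡_; cong; subst; subst₂)

Fin-+-elim : ∀ a {b p} (Q : Fin (a + b) → Set p)
           → (∀ i → Q (i ↑ˡ b)) → (∀ j → Q (a ↑ʳ j)) → ∀ x → Q x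
Fin-+-elim a Q onLeft onRight x with splitAt a x in eq
... | inj₁ i = subst Q (splitAt⁻¹-↑ˡ eq) (onLeft i)
... | inj₂ j = subst Q (splitAt⁻¹-↑ʳ eq) (onRight j)

Bool-ext : ∀ {a b : Bool} → (a ≡ true → b ≡ true) → (b ≡ true → a ≡ true) → a ≡ b
Bool-ext {false} {false} _ _ = P.refl
Bool-ext {false} {true}  _ b⇒a = b⇒a P.refl
Bool-ext {true}  {false} a⇒b _ = P.sym (a⇒b P.refl)
Bool-ext {true}  {true}  _ _ = P.refl

insert : ∀ {n} → Fin n → VSet n → VSet n
insert y M z with z ≟ y
... | yes _ = true
... | no  _ = M z

insert-new : ∀ {n} y (M : VSet n) → y ∈ insert y M
insert-new y M with y ≟ y
... | yes _ = P.refl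
... | no y≢y = contradiction P.refl y≢y

insert-old : ∀ {n} y (M : VSet n) → M ⊆ insert y M
insert-old y M z z∈M with z ≟ y
... | yes _ = P.refl
... | no  _ = z∈M

insert-cases : ∀ {n} y (M : VSet n) z → z ∈ insert y M → z ≡ y ⊎ z ∈ M
insert-cases y M z z∈ with z ≟ y
... | yes z≡y = inj₁ z≡y
... | no  _   = inj₂ z∈

-- A vertex without neighbours in a maximal independent set M lies in M,
-- since otherwise M ∪ {y} would be a larger independent set.
forced : ∀ {n} (K : Graph n) M → MaximalIndependent K M → ∀ y
       → (∀ z → z ∈ M → ¬ Adj K y z) → y ∈ M
forced K M (indep , maximal) y free =
  maximal (insert y M) independent (insert-old y M) y (insert-new y M)
  where
  independent : Independent K (insert y M)
  independent a b a∈ b∈ a~b with insert-cases y M a a∈ | insert-cases y M b b∈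
  ... | inj₁ P.refl | inj₁ P.refl = irrefl K a~b
  ... | inj₁ P.refl | inj₂ b∈M    = free b b∈M a~b
  ... | inj₂ a∈M    | inj₁ P.refl = free a a∈M (symm K a~b)
  ... | inj₂ a∈M    | inj₂ b∈M    = indep a b a∈M b∈M a~b

-- The pullback of G along π : x ~ y  iff  π x ~ π y.  The blowup of v₁ is
-- (definitionally) the pullback along blowMap.
pullback : ∀ {n N} → Graph n → (Fin N → Fin n) → Graph N
pullback G π = record
  { Adj    = λ x y → Adj G (π x) (π y)
  ; symm   = symm G
  ; irrefl = irrefl G
  }

module Pullback {n N : ℕ} (G : Graph n) (π : Fin N → Fin n)
                (σ : Fin n → Fin N) (πσ : ∀ y → π (σ y) ≡ y) where

  H : Graph N
  H = pullback G π

  inflate : VSet n → VSet N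
  inflate M x = M (π x)

  restrict : VSet N → VSet n
  restrict M y = M (σ y)

  -- Vertices with the same image have the same neighbourhood in H, so a
  -- maximal independent set contains both or neither.
  twins : ∀ M → MaximalIndependent H M → ∀ x y → π x ≡ π y → x ∈ M → y ∈ M
  twins M mis x y πx≡πy x∈M = forced H M mis y λ z z∈M y~z →
    proj₁ mis x z x∈M z∈M (subst (λ u → Adj G u (π z)) (P.sym πx≡πy) y~z)

  inflate-MIS : ∀ M → MaximalIndependent G M → MaximalIndependent H (inflate M)
  inflate-MIS M mis@(indep , _) = (λ x y → indep (π x) (π y)) , maximal
    where
    maximal : ∀ T → Independent H T → inflate M ⊆ T → T ⊆ inflate M
    maximal T indepT M⊆T x x∈T = forced G M mis (π x) λ z z∈M πx~z →
      indepT x (σ z) x∈T (M⊆T (σ z) (subst (_∈ M) (P.sym (πσ z)) z∈M))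
        (subst (Adj G (π x)) (P.sym (πσ z)) πx~z)

  restrict-MIS : ∀ M → MaximalIndependent H M → MaximalIndependent G (restrict M)
  restrict-MIS M mis@(indep , maximal) = independent , maximalR
    where
    independent : Independent G (restrict M)
    independent a b a∈ b∈ a~b = indep (σ a) (σ b) a∈ b∈
      (subst₂ (Adj G) (P.sym (πσ a)) (P.sym (πσ b)) a~b)
    maximalR : ∀ T → Independent G T → restrict M ⊆ T → T ⊆ restrict M
    maximalR T indepT M⊆T a a∈T =
      maximal (inflate T) (λ x y → indepT (π x) (π y))
        (λ x x∈M → M⊆T (π x) (twins M mis x (σ (π x)) (P.sym (πσ (π x))) x∈M))
        (σ a) (subst (_∈ T) (P.sym (πσ a)) a∈T)

  inflate-restrict : ∀ M → MaximalIndependent H M → ∀ x → M x ≡ inflate (restrict M) x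
  inflate-restrict M mis x = Bool-ext
    (twins M mis x (σ (π x)) (P.sym (πσ (π x))))
    (twins M mis (σ (π x)) x (πσ (π x)))

-- The vertices of G(t v₁), t = suc s: the copies  copy k  of v₁ and the
-- other vertices  other r = v_{r+2};  blowMap has the section  section.
module BlowupVertices {n : ℕ} (s : ℕ) where

  t : ℕ
  t = suc s

  copy : Fin t → Fin (t + n)
  copy k = k ↑ˡ n

  other : Fin n → Fin (t + n)
  other r = t ↑ʳ r

  blowMap-copy : ∀ k → blowMap t (copy k) ≡ zero
  blowMap-copy k rewrite splitAt-↑ˡ t k n = P.refl

  blowMap-other : ∀ r → blowMap t (other r) ≡ suc r
  blowMap-other r rewrite splitAt-↑ʳ t n r = P.refl

  section : Fin (suc n) → Fin (t + n)
  section zero    = copy zero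
  section (suc r) = other r

  blowMap-section : ∀ y → blowMap t (section y) ≡ y
  blowMap-section zero    = blowMap-copy zero
  blowMap-section (suc r) = blowMap-other r

module _ {c ℓ : Level} (F : Field c ℓ) where
  open Field F hiding (zero) renaming (_+_ to _⊕_)
  open import Algebra.Properties.Ring ring
    using (+-inverseˡ-unique; xyx⁻¹≈y; -1*x≈-x)
  open import Algebra.Properties.CommutativeMonoid.Sum +-commutativeMonoid
    using (sum; sum-cong-≋; sum-replicate-zero; ∑-distrib-+)
  open import Algebra.Properties.Semiring.Sum semiring using (*-distribˡ-sum)
  open import Relation.Binary.Reasoning.Setoid setoid

  Vec : ℕ → Set c
  Vec k = Fin k → Carrier

  lincomb : ∀ {k N} → Vec k → (Fin k → Vec N) → Vec N
  lincomb a v x = ∑ F (λ i → a i * v i x)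

  -- Finite sums.  The sum ∑ of Defs agrees with the library's `sum`, which
  -- lets us reuse the library's summation lemmas.
  ∑≡sum : ∀ {k} (f : Vec k) → ∑ F f ≡ sum f
  ∑≡sum {zero}  f = P.refl
  ∑≡sum {suc k} f = cong (f zero ⊕_) (∑≡sum (λ i → f (suc i)))

  ∑-cong : ∀ {k} {f g : Vec k} → (∀ i → f i ≈ g i) → ∑ F f ≈ ∑ F g
  ∑-cong {f = f} {g} f≈g rewrite ∑≡sum f | ∑≡sum g = sum-cong-≋ f≈g

  ∑-zero : ∀ {k} {f : Vec k} → (∀ i → f i ≈ 0#) → ∑ F f ≈ 0#
  ∑-zero {k} f≈0 =
    trans (∑-cong f≈0) (trans (reflexive (∑≡sum {k} (λ _ → 0#))) (sum-replicate-zero k))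

  ∑-+ : ∀ {k} (f g : Vec k) → ∑ F (λ i → f i ⊕ g i) ≈ ∑ F f ⊕ ∑ F g
  ∑-+ f g rewrite ∑≡sum f | ∑≡sum g | ∑≡sum (λ i → f i ⊕ g i) = ∑-distrib-+ f g

  ∑-*ˡ : ∀ {k} a (f : Vec k) → ∑ F (λ i → a * f i) ≈ a * ∑ F f
  ∑-*ˡ a f rewrite ∑≡sum f | ∑≡sum (λ i → a * f i) = sym (*-distribˡ-sum a f)

  ∑-split : ∀ a {b} (f : Vec (a + b))
          → ∑ F f ≈ ∑ F (λ i → f (i ↑ˡ b)) ⊕ ∑ F (λ j → f (a ↑ʳ j))
  ∑-split zero    f = sym (+-identityˡ _)
  ∑-split (suc a) f = trans (+-congˡ (∑-split a (λ i → f (suc i)))) (sym (+-assoc _ _ _))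

  δ : ∀ {k} → Fin k → Vec k
  δ zero    zero    = 1#
  δ zero    (suc _) = 0#
  δ (suc _) zero    = 0#
  δ (suc j) (suc k) = δ j k

  ∑-δ : ∀ {k} (j : Fin k) (f : Vec k) → ∑ F (λ i → δ j i * f i) ≈ f j
  ∑-δ zero    f =
    trans (+-cong (*-identityˡ _) (∑-zero (λ i → zeroˡ (f (suc i))))) (+-identityʳ _)
  ∑-δ (suc j) f = trans (+-cong (zeroˡ _) (∑-δ j (λ i → f (suc i)))) (+-identityˡ _)

  δ-sym : ∀ {k} (i j : Fin k) → δ i j ≡ δ j i
  δ-sym zero    zero    = P.refl
  δ-sym zero    (suc _) = P.refl
  δ-sym (suc _) zero    = P.refl
  δ-sym (suc i) (suc j) = δ-sym i j

  lincomb-zero : ∀ {k N} {a : Vec k} (v : Fin k → Vec N)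
               → (∀ i → a i ≈ 0#) → ∀ x → lincomb a v x ≈ 0#
  lincomb-zero v a≈0 x = ∑-zero (λ i → trans (*-cong (a≈0 i) refl) (zeroˡ _))

  lincomb-split : ∀ {m s N} (A : Vec (m + s)) (u : Fin m → Vec N) (v : Fin s → Vec N) x
                → lincomb A (u ++ v) x
                  ≈ lincomb (λ i → A (i ↑ˡ s)) u x ⊕ lincomb (λ j → A (m ↑ʳ j)) v x
  lincomb-split {m} A u v x = trans (∑-split m (λ i → A i * (u ++ v) i x))
    (+-cong (∑-cong λ i → *-cong refl (reflexive (cong (λ f → f x) (lookup-++ˡ u v i))))
            (∑-cong λ j → *-cong refl (reflexive (cong (λ f → f x) (lookup-++ʳ u v j)))))

  lincomb-++ : ∀ {m s N} (a : Vec m) (b : Vec s) (u : Fin m → Vec N) (v : Fin s → Vec N) x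
             → lincomb (a ++ b) (u ++ v) x ≈ lincomb a u x ⊕ lincomb b v x
  lincomb-++ a b u v x = trans (lincomb-split (a ++ b) u v x)
    (+-cong (∑-cong λ i → *-cong (reflexive (lookup-++ˡ a b i)) refl)
            (∑-cong λ j → *-cong (reflexive (lookup-++ʳ a b j)) refl))

  hasDimension-resp : ∀ {N d q r} {W : Vec N → Set q} {W' : Vec N → Set r}
                    → (∀ w → W w → W' w) → (∀ w → W' w → W w)
                    → HasDimension F W d → HasDimension F W' d
  hasDimension-resp W⇒W' W'⇒W D = record
    { basis = basis ; inW = λ i → W⇒W' _ (inW i) ; linIndep = linIndep
    ; spans = λ w w∈W' → spans w (W'⇒W w w∈W') }
    where open HasDimension D

  if-cong : ∀ β {u v} → u ≈ v → (if β then u else 0#) ≈ (if β then v else 0#)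
  if-cong true  u≈v = u≈v
  if-cong false _   = refl

  if-zero : ∀ β → (if β then 0# else 0#) ≈ 0#
  if-zero true  = refl
  if-zero false = refl

  ∑-if : ∀ {k} β (f : Vec k)
       → ∑ F (λ i → if β then f i else 0#) ≈ (if β then ∑ F f else 0#)
  ∑-if true  f = refl
  ∑-if {k} false f = ∑-zero {k} (λ _ → refl)

  weightOf-cong : ∀ {n} {u v : Vec n} M → (∀ x → u x ≈ v x)
                → weightOf F u M ≈ weightOf F v M
  weightOf-cong M u≈v = ∑-cong λ x → if-cong (M x) (u≈v x)

  weightOf-set : ∀ {n} (w : Vec n) {M M'} → (∀ x → M x ≡ M' x)
               → weightOf F w M ≈ weightOf F w M'
  weightOf-set w M≡M' = ∑-cong λ x → reflexive (cong (λ β → if β then w x else 0#) (M≡M' x))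

  wellCovered-resp : ∀ {n} (G : Graph n) {u v} → (∀ x → u x ≈ v x)
                   → WellCovered F G u → WellCovered F G v
  wellCovered-resp G u≈v wc M M' mis mis' =
    trans (sym (weightOf-cong M u≈v)) (trans (wc M M' mis mis') (weightOf-cong M' u≈v))

  wellCovered-zero : ∀ {n} (G : Graph n) → WellCovered F G (λ _ → 0#)
  wellCovered-zero G M M' _ _ = trans (weightOf-zero M) (sym (weightOf-zero M'))
    where
    weightOf-zero : ∀ M → weightOf F (λ _ → 0#) M ≈ 0#
    weightOf-zero M = ∑-zero λ x → if-zero (M x)

  module _ {n N : ℕ} (G : Graph n) (π : Fin N → Fin n)
           (σ : Fin n → Fin N) (πσ : ∀ y → π (σ y) ≡ y) (w : Vec N) (q : Vec n)
           (same-weight : ∀ M → weightOf F w (Pullback.inflate G π σ πσ M) ≈ weightOf F q M)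
           where
    open Pullback G π σ πσ

    wellCovered-pullback⁺ : WellCovered F G q → WellCovered F H w
    wellCovered-pullback⁺ wc M M' mis mis' = begin
      weightOf F w M                        ≈⟨ weightOf-set w (inflate-restrict M mis) ⟩
      weightOf F w (inflate (restrict M))   ≈⟨ same-weight (restrict M) ⟩
      weightOf F q (restrict M)             ≈⟨ wc _ _ (restrict-MIS M mis) (restrict-MIS M' mis') ⟩
      weightOf F q (restrict M')            ≈⟨ same-weight (restrict M') ⟨
      weightOf F w (inflate (restrict M'))  ≈⟨ weightOf-set w (inflate-restrict M' mis') ⟨
      weightOf F w M'                       ∎

    wellCovered-pullback⁻ : WellCovered F H w → WellCovered F G q
    wellCovered-pullback⁻ wc M M' mis mis' = begin
      weightOf F q M              ≈⟨ same-weight M ⟨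
      weightOf F w (inflate M)    ≈⟨ wc _ _ (inflate-MIS M mis) (inflate-MIS M' mis') ⟩
      weightOf F w (inflate M')   ≈⟨ same-weight M' ⟩
      weightOf F q M'             ∎

  module Preimage {N n : ℕ} (p : Vec N → Vec n)
    (p-cong : ∀ {u v} → (∀ x → u x ≈ v x) → ∀ y → p u y ≈ p v y)
    (p-+ : ∀ u v y → p (λ x → u x ⊕ v x) y ≈ p u y ⊕ p v y)
    (p-* : ∀ a u y → p (λ x → a * u x) y ≈ a * p u y) where

    Kernel : Vec N → Set ℓ
    Kernel v = ∀ y → p v y ≈ 0#

    p-0 : ∀ y → p (λ _ → 0#) y ≈ 0#
    p-0 y = trans (p-cong (λ _ → sym (zeroˡ 0#)) y) (trans (p-* 0# (λ _ → 0#) y) (zeroˡ _))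

    p-neg : ∀ u y → p (λ x → - u x) y ≈ - p u y
    p-neg u y = trans (p-cong (λ x → sym (-1*x≈-x (u x))) y) (trans (p-* (- 1#) u y) (-1*x≈-x _))

    p-lincomb : ∀ {k} (a : Vec k) (v : Fin k → Vec N) y
              → p (lincomb a v) y ≈ lincomb a (λ i → p (v i)) y
    p-lincomb {zero}  a v y = p-0 y
    p-lincomb {suc k} a v y = trans (p-+ _ _ y)
      (+-cong (p-* (a zero) (v zero) y) (p-lincomb (λ i → a (suc i)) (λ i → v (suc i)) y))

    -- If p has a section ℓ and W is a subspace of dimension m, then the
    -- preimage p⁻¹(W) has dimension m + dim ker p; a basis is given by the
    -- images ℓ bᵢ of a basis of W followed by a basis of ker p.
    preimage-dimension : ∀ {q m s} {W : Vec n → Set q}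
      → (∀ {u v} → (∀ y → u y ≈ v y) → W u → W v) → W (λ _ → 0#)
      → (ℓ : Vec n → Vec N) → (∀ f y → p (ℓ f) y ≈ f y)
      → HasDimension F W m → HasDimension F Kernel s
      → HasDimension F (λ w → W (p w)) (m + s)
    preimage-dimension {m = m} {s} {W} W-resp W-0 ℓ pℓ DW DK = record
      { basis = basis ; inW = inW ; linIndep = linIndep ; spans = spans }
      where
      module W = HasDimension DW
      module K = HasDimension DK

      ℓb : Fin m → Vec N
      ℓb i = ℓ (W.basis i)

      basis : Fin (m + s) → Vec N
      basis = ℓb ++ K.basis

      inW : ∀ i → W (p (basis i))
      inW = Fin-+-elim m (λ i → W (p (basis i)))
        (λ i → subst (λ v → W (p v)) (P.sym (lookup-++ˡ ℓb K.basis i))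
                 (W-resp (λ y → sym (pℓ (W.basis i) y)) (W.inW i)))
        (λ j → subst (λ v → W (p v)) (P.sym (lookup-++ʳ ℓb K.basis j))
                 (W-resp (λ y → sym (K.inW j y)) W-0))

      p-first : ∀ (a : Vec m) y → p (lincomb a ℓb) y ≈ lincomb a W.basis y
      p-first a y = trans (p-lincomb a ℓb y) (∑-cong λ i → *-cong refl (pℓ (W.basis i) y))

      p-second : ∀ (b : Vec s) y → p (lincomb b K.basis) y ≈ 0#
      p-second b y = trans (p-lincomb b K.basis y)
                           (∑-zero λ j → trans (*-cong refl (K.inW j y)) (zeroʳ _))

      linIndep : ∀ A → (∀ x → lincomb A basis x ≈ 0#) → ∀ i → A i ≈ 0#
      linIndep A A≈0 = Fin-+-elim m (λ i → A i ≈ 0#) a≈0 b≈0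
        where
        a : Vec m
        a i = A (i ↑ˡ s)
        b : Vec s
        b j = A (m ↑ʳ j)
        split≈0 : ∀ x → lincomb a ℓb x ⊕ lincomb b K.basis x ≈ 0#
        split≈0 x = trans (sym (lincomb-split A ℓb K.basis x)) (A≈0 x)
        -- Applying p kills the kernel block and leaves Σ aᵢ bᵢ = 0.
        a≈0 : ∀ i → a i ≈ 0#
        a≈0 = W.linIndep a λ y → begin
          lincomb a W.basis y                               ≈⟨ +-identityʳ _ ⟨
          lincomb a W.basis y ⊕ 0#                          ≈⟨ +-cong (p-first a y) (p-second b y) ⟨
          p (lincomb a ℓb) y ⊕ p (lincomb b K.basis) y      ≈⟨ p-+ _ _ y ⟨
          p (λ x → lincomb a ℓb x ⊕ lincomb b K.basis x) y  ≈⟨ p-cong split≈0 y ⟩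
          p (λ _ → 0#) y                                    ≈⟨ p-0 y ⟩
          0#                                                ∎
        b≈0 : ∀ j → b j ≈ 0#
        b≈0 = K.linIndep b λ x → trans (sym (+-identityˡ _))
          (trans (+-cong (sym (lincomb-zero ℓb a≈0 x)) refl) (split≈0 x))

      spans : ∀ w → W (p w) → ∃ λ A → ∀ x → w x ≈ lincomb A basis x
      spans w pw∈W = a ++ b , λ x → trans (w≈ x) (sym (lincomb-++ a b ℓb K.basis x))
        where
        a : Vec m
        a = proj₁ (W.spans (p w) pw∈W)
        first : Vec N
        first = lincomb a ℓb
        rest∈K : Kernel (λ x → w x ⊕ - first x)
        rest∈K y = trans (p-+ w _ y) (trans
          (+-cong (proj₂ (W.spans (p w) pw∈W) y) (trans (p-neg first y) (-‿cong (p-first a y))))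
          (-‿inverseʳ _))
        b : Vec s
        b = proj₁ (K.spans _ rest∈K)
        w≈ : ∀ x → w x ≈ first x ⊕ lincomb b K.basis x
        w≈ x = trans (sym (xyx⁻¹≈y (first x) (w x)))
                 (trans (+-assoc _ _ _) (+-congˡ (proj₂ (K.spans _ rest∈K) x)))

  module Blowup {n : ℕ} (s : ℕ) where
    open BlowupVertices {n} s

    push : Vec (t + n) → Vec (suc n)
    push w zero    = ∑ F (λ k → w (copy k))
    push w (suc r) = w (other r)

    push-cong : ∀ {u v} → (∀ x → u x ≈ v x) → ∀ y → push u y ≈ push v y
    push-cong u≈v zero    = ∑-cong λ k → u≈v (copy k)
    push-cong u≈v (suc r) = u≈v (other r)

    push-+ : ∀ u v y → push (λ x → u x ⊕ v x) y ≈ push u y ⊕ push v y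
    push-+ u v zero    = ∑-+ (λ k → u (copy k)) (λ k → v (copy k))
    push-+ u v (suc r) = refl

    push-* : ∀ a u y → push (λ x → a * u x) y ≈ a * push u y
    push-* a u zero    = ∑-*ˡ a (λ k → u (copy k))
    push-* a u (suc r) = refl

    weightOf-inflate : ∀ w M → weightOf F w (λ x → M (blowMap t x)) ≈ weightOf F (push w) M
    weightOf-inflate w M = trans (∑-split t (λ x → if M (blowMap t x) then w x else 0#))
      (+-cong (trans (∑-cong λ k → reflexive (cong (λ y → if M y then w (copy k) else 0#)
                                                    (blowMap-copy k)))
                     (∑-if (M zero) (λ k → w (copy k))))
              (∑-cong λ r → reflexive (cong (λ y → if M y then w (other r) else 0#)
                                             (blowMap-other r))))

    onFirstCopy : Carrier → Vec t
    onFirstCopy a = a ∷ (λ _ → 0#)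

    spread : Vec (suc n) → Vec (t + n)
    spread f = onFirstCopy (f zero) ++ (λ r → f (suc r))

    push-spread : ∀ f y → push (spread f) y ≈ f y
    push-spread f zero    =
      trans (∑-cong λ k → reflexive (lookup-++ˡ (onFirstCopy (f zero)) (λ r → f (suc r)) k))
            (trans (+-congˡ (∑-zero {s} (λ _ → refl))) (+-identityʳ _))
    push-spread f (suc r) = reflexive (lookup-++ʳ (onFirstCopy (f zero)) (λ r → f (suc r)) r)

    -- The kernel of push is spanned by  e_{copy (j+1)} - e_{copy 0},  j < s.
    kernelBasis : Fin s → Vec (t + n)
    kernelBasis j = ((- 1#) ∷ δ j) ++ (λ _ → 0#)

    kernelBasis-copy : ∀ j k → kernelBasis j (copy k) ≡ ((- 1#) ∷ δ j) k
    kernelBasis-copy j k = lookup-++ˡ ((- 1#) ∷ δ j) _ k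

    kernelBasis-other : ∀ j r → kernelBasis j (other r) ≡ 0#
    kernelBasis-other j r = lookup-++ʳ ((- 1#) ∷ δ j) _ r

    comb-copy₀ : ∀ b → lincomb b kernelBasis (copy zero) ≈ - ∑ F b
    comb-copy₀ b = trans (∑-cong λ j → trans (*-cong refl (reflexive (kernelBasis-copy j zero)))
                                             (*-comm _ _))
                         (trans (∑-*ˡ (- 1#) b) (-1*x≈-x _))

    comb-copy : ∀ b k → lincomb b kernelBasis (copy (suc k)) ≈ b k
    comb-copy b k = trans (∑-cong λ j → trans (*-cong refl (reflexive (entry j))) (*-comm _ _))
                          (∑-δ k b)
      where
      entry : ∀ j → kernelBasis j (copy (suc k)) ≡ δ k j
      entry j = P.trans (kernelBasis-copy j (suc k)) (δ-sym j k)

    comb-other : ∀ b r → lincomb b kernelBasis (other r) ≈ 0#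
    comb-other b r = ∑-zero λ j → trans (*-cong refl (reflexive (kernelBasis-other j r))) (zeroʳ _)

    kernel-dimension : HasDimension F (λ v → ∀ y → push v y ≈ 0#) s
    kernel-dimension = record
      { basis = kernelBasis ; inW = inKernel ; linIndep = linIndep ; spans = spans }
      where
      inKernel : ∀ j y → push (kernelBasis j) y ≈ 0#
      inKernel j zero    = trans (∑-cong λ k → reflexive (kernelBasis-copy j k))
                                 (trans (+-congˡ ∑δ≈1) (-‿inverseˡ 1#))
        where
        ∑δ≈1 : ∑ F (δ j) ≈ 1#
        ∑δ≈1 = trans (∑-cong λ k → sym (*-identityʳ (δ j k))) (∑-δ j (λ _ → 1#))
      inKernel j (suc r) = reflexive (kernelBasis-other j r)

      linIndep : ∀ b → (∀ x → lincomb b kernelBasis x ≈ 0#) → ∀ j → b j ≈ 0#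
      linIndep b comb≈0 k = trans (sym (comb-copy b k)) (comb≈0 (copy (suc k)))

      spans : ∀ v → (∀ y → push v y ≈ 0#) → ∃ λ b → ∀ x → v x ≈ lincomb b kernelBasis x
      -- The coefficients are the values on the copies 1 … s; the value on
      -- copy 0 and on the other vertices is then forced by v ∈ ker push.
      spans v v∈K = b , Fin-+-elim t (λ x → v x ≈ lincomb b kernelBasis x) onCopy onOther
        where
        b : Vec s
        b j = v (copy (suc j))
        onCopy : ∀ k → v (copy k) ≈ lincomb b kernelBasis (copy k)
        onCopy zero    = trans (+-inverseˡ-unique _ _ (v∈K zero)) (sym (comb-copy₀ b))
        onCopy (suc k) = sym (comb-copy b k)
        onOther : ∀ r → v (other r) ≈ lincomb b kernelBasis (other r)
        onOther r = trans (v∈K (suc r)) (sym (comb-other b r))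

  -- wcdim(G(t v₁)) = wcdim(G) + (t - 1), for t = suc s: WC(G(t v₁)) is the
  -- preimage of WC(G) under push, which has the section spread and an
  -- s-dimensional kernel.
  blowup-wcdim : ∀ {n} (G : Graph (suc n)) (s m : ℕ)
               → WCDim F G m → WCDim F (blowup G (suc s)) (m + s)
  blowup-wcdim {n} G s m D = hasDimension-resp
    (λ w → wellCovered-pullback⁺ G (blowMap t) section blowMap-section w (push w)
                                 (weightOf-inflate w))
    (λ w → wellCovered-pullback⁻ G (blowMap t) section blowMap-section w (push w)
                                 (weightOf-inflate w))
    (preimage-dimension (wellCovered-resp G) (wellCovered-zero G) spread push-spread
                        D kernel-dimension)
    where
    open BlowupVertices {n} s
    open Blowup {n} s
    open Preimage push push-cong push-+ push-*

mainTheorem6 : ∀ {c ℓ : Level} (F : Field c ℓ) {n : ℕ} (G : Graph (suc n)) (m t : ℕ)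
    → 1 ≤ t → WCDim F G m → WCDim F (blowup G t) (m + t ∸ 1)
mainTheorem6 F G m zero    ()
mainTheorem6 F G m (suc s) _ D =
  subst (WCDim F (blowup G (suc s))) (cong (_∸ 1) (P.sym (+-suc m s))) (blowup-wcdim F G s m D)
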